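{- If $G$ is a connected graph that is claw-$o_{ -1}$-heavy and $P_4$-free, then $G$ is traceable.
   Context: All graphs are finite and simple; $d(v)$ is the degree of $v$ in $G$. A claw is $K_{1,3}$. $G$ (on $n$ vertices) is claw-$o_{ -1}$-heavy if every induced subgraph of $G$ isomorphic to $K_{1,3}$ contains two nonadjacent vertices whose degree sum in $G$ is at least $n-1$. $P_4$ is the path on 4 vertices; $G$ is $P_4$-free if it has no induced subgraph isomorphic to $P_4$. Traceable means having a path through all vertices. -}

module Defs where

open import Data.Nat using (ℕ; _+_; _∸_; _≥_)
open import Data.Bool using (Bool; true; false)
open import Data.Fin using (Fin)
open import Data.List using (List; []; _∷_; filter; length)
open import Data.List.Base using (allFin)
open import Data.List.Membership.Propositional using (_∈_)
open import Data.List.Relation.Unary.Unique.Propositional using (Unique)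
open import Data.Product using (Σ; ∃; _×_; _,_)
open import Data.Sum using (_⊎_)
open import Relation.Binary.PropositionalEquality using (_≡_)
open import Relation.Nullary using (¬_)
open import Data.Bool.Properties using (T?)
open import Data.Bool using (T)

record Graph (n : ℕ) : Set where
  field
    adj   : Fin n → Fin n → Bool
    sym   : ∀ u v → adj u v ≡ adj v u
    irref : ∀ v → adj v v ≡ false
open Graph public

Adj : ∀ {n} → Graph n → Fin n → Fin n → Set
Adj G u v = T (adj G u v)

degree : ∀ {n} → Graph n → Fin n → ℕ
degree {n} G v = length (filter (λ u → T? (adj G v u)) (allFin n))

data Walk {n} (G : Graph n) : Fin n → Fin n → Set where
  here : ∀ {v} → Walk G v v
  step : ∀ {u w v} → Adj G u w → Walk G w v → Walk G u v

Connected : ∀ {n} → Graph n → Set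
Connected G = ∀ u v → Walk G u v

record InducedClaw {n} (G : Graph n) (c x y z : Fin n) : Set where
  field
    cx : Adj G c x
    cy : Adj G c y
    cz : Adj G c z
    x≢y : ¬ x ≡ y
    x≢z : ¬ x ≡ z
    y≢z : ¬ y ≡ z
    ¬xy : ¬ Adj G x y
    ¬xz : ¬ Adj G x z
    ¬yz : ¬ Adj G y z

-- every induced claw has two nonadjacent vertices (necessarily two leaves)
-- with degree sum at least n - 1
ClawO₋₁Heavy : ∀ {n} → Graph n → Set
ClawO₋₁Heavy {n} G = ∀ c x y z → InducedClaw G c x y z →
  (degree G x + degree G y ≥ n ∸ 1) ⊎ (degree G x + degree G z ≥ n ∸ 1)
    ⊎ (degree G y + degree G z ≥ n ∸ 1)

record InducedP4 {n} (G : Graph n) (a b c d : Fin n) : Set where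
  field
    ab : Adj G a b
    bc : Adj G b c
    cd : Adj G c d
    ¬ac : ¬ Adj G a c
    ¬bd : ¬ Adj G b d
    ¬ad : ¬ Adj G a d

P4Free : ∀ {n} → Graph n → Set
P4Free G = ∀ a b c d → ¬ InducedP4 G a b c d

data IsPath {n} (G : Graph n) : List (Fin n) → Set where
  nil  : IsPath G []
  one  : ∀ {v} → IsPath G (v ∷ [])
  cons : ∀ {u v vs} → Adj G u v → IsPath G (v ∷ vs) → IsPath G (u ∷ v ∷ vs)

Traceable : ∀ {n} → Graph n → Set
Traceable {n} G = Σ (List (Fin n)) λ p →
  IsPath G p × Unique p × (∀ v → v ∈ p)

module Submission where

-- Grow a path P greedily. A vertex x off P joins directly if it is adjacent to an end of P. Otherwise,
-- since a connected P₄-free graph has diameter at most 2, x has common neighbours c and d with the two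
-- ends, which extend P themselves if they lie off P. If the ends of P are adjacent, x enters the cycle
-- they close next to c; if not, P₄-freeness makes one of c, d, call it b, adjacent to both ends. Unless
-- x slips in next to b, b together with x and the two path neighbours p, q of b forms an induced claw,
-- so two of x, p, q have degree sum at least n - 1. Ore's counting along P and off P then exhibits a
-- rerouting of P that absorbs x.

open import Algebra.Properties.CommutativeSemigroup using (interchange)
import Algebra.Solver.CommutativeMonoid as CommutativeMonoidSolver
open import Data.Bool using (Bool; true; false; T)
open import Data.Empty using (⊥-elim)
open import Data.Fin as Fin using (Fin)
open import Data.Fin.Properties using (all?; ¬∀⟶∃¬) renaming (_≟_ to _≟ᶠ_)
open import Data.List using (List; []; _∷_; _++_; [_]; length; reverse; filter; allFin)
open import Data.List.Properties using (length-++; unfold-reverse; length-tabulate)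
open import Data.List.Membership.Propositional using (_∈_; _∉_)
open import Data.List.Membership.Propositional.Properties using (∈-allFin; ∈-++⁺ˡ; ∈-++⁺ʳ; ∈-∃++)
import Data.List.Membership.DecPropositional as DecMembership
open import Data.List.Relation.Unary.Any using (here; there)
open import Data.List.Relation.Unary.All using (lookup)
open import Data.List.Relation.Unary.All.Properties using (¬Any⇒All¬; ++⁻ʳ)
open import Data.List.Relation.Unary.Unique.Propositional using (Unique; []; _∷_)
open import Data.List.Relation.Unary.Unique.Propositional.Properties using (allFin⁺; Unique[x∷xs]⇒x∉xs)
open import Data.List.Relation.Binary.Permutation.Propositional using (_↭_; ↭-sym; ↭-trans; ↭-refl; ↭⇒↭ₛ)
open import Data.List.Relation.Binary.Permutation.Propositional.Properties
  using (↭-length; ↭-reverse; ++⁺ʳ; ++-comm; ∈-resp-↭; ++-commutativeMonoid)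
import Data.List.Relation.Binary.Permutation.Setoid.Properties as Setoid↭
open import Data.Nat using (ℕ; zero; suc; _+_; _∸_; _≤_; _<_; z≤n; s≤s)
open import Data.Nat.Properties
open import Data.Nat.Solver using (module +-*-Solver)
open import Data.Product using (∃; ∃-syntax; _×_; _,_)
open import Data.Sum using (_⊎_; inj₁; inj₂)
open import Data.Unit using (tt)
open import Function using (_∘_)
open import Relation.Binary.Definitions using (DecidableEquality)
open import Relation.Binary.PropositionalEquality hiding ([_])
open import Relation.Nullary using (¬_; Dec; yes; no)
open import Relation.Nullary.Decidable using (T?)
open import Defs hiding (sym)

module _ {A : Set} where
  open CommutativeMonoidSolver (++-commutativeMonoid {A = A}) using (solve; _⊕_; _⊜_)

  Unique-∷ : ∀ {y : A} {P} → y ∉ P → Unique P → Unique (y ∷ P)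
  Unique-∷ {P = P} y∉ uP = ¬Any⇒All¬ P y∉ ∷ uP

  Unique-resp-↭ : ∀ {vs ws : List A} → vs ↭ ws → Unique vs → Unique ws
  Unique-resp-↭ vs↭ws = Setoid↭.Unique-resp-↭ (setoid A) (↭⇒↭ₛ vs↭ws)

  Unique-++⇒disjoint : ∀ L {R : List A} {y w} → Unique (L ++ R) → y ∈ L → w ∈ R → y ≢ w
  Unique-++⇒disjoint (_ ∷ L) (y∉ ∷ _)  (here refl) w∈R = lookup (++⁻ʳ L y∉) w∈R
  Unique-++⇒disjoint (_ ∷ L) (_ ∷ uLR) (there y∈L) w∈R = Unique-++⇒disjoint L uLR y∈L w∈R

  via-reverse : ∀ R rest {vs ws : List A} → vs ↭ reverse R ++ rest → R ++ rest ↭ ws → vs ↭ ws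
  via-reverse R rest vs↭ ↭ws = ↭-trans vs↭ (↭-trans (++⁺ʳ rest (↭-reverse R)) ↭ws)

  reverse-around : ∀ L b M → reverse M ++ b ∷ reverse L ↭ L ++ b ∷ M
  reverse-around L b M = via-reverse M ([ b ] ++ reverse L) ↭-refl
    (↭-trans (solve 3 (λ M b RL → M ⊕ b ⊕ RL ⊜ RL ⊕ b ⊕ M) ↭-refl M [ b ] (reverse L))
             (++⁺ʳ ([ b ] ++ M) (↭-reverse L)))

𝟙 : Bool → ℕ
𝟙 true  = 1
𝟙 false = 0

𝟙≤1 : ∀ b → 𝟙 b ≤ 1
𝟙≤1 true  = s≤s z≤n
𝟙≤1 false = z≤n

module Sums {A : Set} (_≟_ : DecidableEquality A) where
  open DecMembership _≟_ using (_∈?_)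

  ∑ : (A → ℕ) → List A → ℕ
  ∑ w []      = 0
  ∑ w (a ∷ l) = w a + ∑ w l

  ∑-++ : ∀ w l m → ∑ w (l ++ m) ≡ ∑ w l + ∑ w m
  ∑-++ w []      m = refl
  ∑-++ w (a ∷ l) m = trans (cong (w a +_) (∑-++ w l m)) (sym (+-assoc (w a) (∑ w l) (∑ w m)))

  ∑-cong : ∀ {v w} l → (∀ z → v z ≡ w z) → ∑ v l ≡ ∑ w l
  ∑-cong []      eq = refl
  ∑-cong (a ∷ l) eq = cong₂ _+_ (eq a) (∑-cong l eq)

  ∑-+ : ∀ v w l → ∑ (λ z → v z + w z) l ≡ ∑ v l + ∑ w l
  ∑-+ v w []      = refl
  ∑-+ v w (a ∷ l) = trans (cong (v a + w a +_) (∑-+ v w l))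
                          (interchange +-commutativeSemigroup (v a) (w a) (∑ v l) (∑ w l))

  ∑-length : ∀ l → ∑ (λ _ → 1) l ≡ length l
  ∑-length []      = refl
  ∑-length (a ∷ l) = cong suc (∑-length l)

  ∑-filter : ∀ (f : A → Bool) l → length (filter (T? ∘ f) l) ≡ ∑ (𝟙 ∘ f) l
  ∑-filter f []      = refl
  ∑-filter f (a ∷ l) with f a
  ... | true  = cong suc (∑-filter f l)
  ... | false = ∑-filter f l

  ∑-around-< : ∀ w L b M → ∑ w L < length L → w b ≤ 2 → ∑ w M < length M →
               ∑ w (L ++ b ∷ M) < length (L ++ b ∷ M)
  ∑-around-< w L b M L< b≤2 M< = +-cancelʳ-≤ 2 _ _ (begin
    suc (∑ w (L ++ b ∷ M)) + 2     ≡⟨ cong (λ t → suc t + 2) (∑-++ w L (b ∷ M)) ⟩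
    suc (SL + (w b + SM)) + 2      ≡⟨ solve 3 (λ SL wb SM → con 1 :+ (SL :+ (wb :+ SM)) :+ con 2
                                                    := (con 1 :+ SL) :+ wb :+ (con 1 :+ SM) :+ con 1)
                                               refl SL (w b) SM ⟩
    suc SL + w b + suc SM + 1      ≤⟨ +-monoˡ-≤ 1 (+-mono-≤ (+-mono-≤ L< b≤2) M<) ⟩
    length L + 2 + length M + 1    ≡⟨ solve 2 (λ l m → l :+ con 2 :+ m :+ con 1 := l :+ (con 1 :+ m) :+ con 2)
                                               refl (length L) (length M) ⟩
    length L + suc (length M) + 2  ≡⟨ cong (_+ 2) (sym (length-++ L)) ⟩
    length (L ++ b ∷ M) + 2        ∎)
    where
    open ≤-Reasoning
    open +-*-Solver using (solve; _:+_; _:=_; con)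
    SL = ∑ w L
    SM = ∑ w M

  ∈⇒≤∑ : ∀ w {x} {l} → x ∈ l → w x ≤ ∑ w l
  ∈⇒≤∑ w {l = a ∷ l} (here refl) = m≤m+n (w a) (∑ w l)
  ∈⇒≤∑ w {l = a ∷ l} (there x∈) = ≤-trans (∈⇒≤∑ w x∈) (m≤n+m (∑ w l) (w a))

  outside : List A → (A → ℕ) → A → ℕ
  outside p w z with z ∈? p
  ... | yes _ = 0
  ... | no _  = w z

  outside-∈ : ∀ {p} w {z} → z ∈ p → outside p w z ≡ 0
  outside-∈ {p} w {z} z∈ with z ∈? p
  ... | yes _  = refl
  ... | no z∉ = ⊥-elim (z∉ z∈)

  outside-∉ : ∀ {p} w {z} → z ∉ p → outside p w z ≡ w z
  outside-∉ {p} w {z} z∉ with z ∈? p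
  ... | yes z∈ = ⊥-elim (z∉ z∈)
  ... | no _   = refl

  point : A → (A → ℕ) → A → ℕ
  point a w z with z ≟ a
  ... | yes _ = w z
  ... | no _  = 0

  ∑-point-∉ : ∀ a w l → a ∉ l → ∑ (point a w) l ≡ 0
  ∑-point-∉ a w []      _  = refl
  ∑-point-∉ a w (y ∷ l) a∉ with y ≟ a
  ... | yes refl = ⊥-elim (a∉ (here refl))
  ... | no _     = ∑-point-∉ a w l (a∉ ∘ there)

  ∑-point-∈ : ∀ a w {l} → Unique l → a ∈ l → ∑ (point a w) l ≡ w a
  ∑-point-∈ a w {y ∷ l} uyl (here refl) with y ≟ y
  ... | yes _ = trans (cong (w y +_) (∑-point-∉ y w l (Unique[x∷xs]⇒x∉xs uyl))) (+-identityʳ (w y))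
  ... | no y≢y = ⊥-elim (y≢y refl)
  ∑-point-∈ a w {y ∷ l} uyl@(_ ∷ ul) (there a∈) with y ≟ a
  ... | yes refl = ⊥-elim (Unique[x∷xs]⇒x∉xs uyl a∈)
  ... | no _     = ∑-point-∈ a w ul a∈

  outside-∷ : ∀ {a p} w z → a ∉ p → outside p w z ≡ point a w z + outside (a ∷ p) w z
  outside-∷ {a} {p} w z a∉ with z ≟ a | z ∈? p | z ∈? (a ∷ p)
  ... | yes refl | yes z∈ | _         = ⊥-elim (a∉ z∈)
  ... | yes refl | no _   | yes _     = sym (+-identityʳ (w z))
  ... | yes refl | no _   | no z∉     = ⊥-elim (z∉ (here refl))
  ... | no _     | yes _  | yes _     = refl
  ... | no _     | yes z∈ | no z∉     = ⊥-elim (z∉ (there z∈))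
  ... | no z≢a   | no _   | yes (here z≡a) = ⊥-elim (z≢a z≡a)
  ... | no _     | no z∉  | yes (there z∈) = ⊥-elim (z∉ z∈)
  ... | no _     | no _   | no _      = refl

  module _ {U : List A} (U-unique : Unique U) (U-complete : ∀ z → z ∈ U) where

    ∑-split : ∀ w {p} → Unique p → ∑ w U ≡ ∑ w p + ∑ (outside p w) U
    ∑-split w {[]} _ = ∑-cong U (λ z → sym (outside-∉ {[]} w λ ()))
    ∑-split w {a ∷ p} uap@(_ ∷ up) = begin
      ∑ w U                                         ≡⟨ ∑-split w up ⟩
      ∑ w p + ∑ (outside p w) U                     ≡⟨ cong (∑ w p +_) (∑-cong U λ z →
                                                         outside-∷ w z (Unique[x∷xs]⇒x∉xs uap)) ⟩
      ∑ w p + ∑ (λ z → point a w z + outside′ z) U  ≡⟨ cong (∑ w p +_) (∑-+ (point a w) outside′ U) ⟩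
      ∑ w p + (∑ (point a w) U + ∑ outside′ U)      ≡⟨ cong (λ t → ∑ w p + (t + ∑ outside′ U))
                                                         (∑-point-∈ a w U-unique (U-complete a)) ⟩
      ∑ w p + (w a + ∑ outside′ U)                  ≡⟨ sym (+-assoc (∑ w p) (w a) (∑ outside′ U)) ⟩
      ∑ w p + w a + ∑ outside′ U                    ≡⟨ cong (_+ ∑ outside′ U) (+-comm (∑ w p) (w a)) ⟩
      w a + ∑ w p + ∑ outside′ U                    ∎
      where
      open ≡-Reasoning
      outside′ : A → ℕ
      outside′ = outside (a ∷ p) w

  ∑-mono-unless : ∀ {h k : A → ℕ} (Q : A → Set) → (∀ z → Q z ⊎ h z ≤ k z) →
                  ∀ l → ∃ Q ⊎ ∑ h l ≤ ∑ k l
  ∑-mono-unless Q pt [] = inj₂ z≤n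
  ∑-mono-unless Q pt (a ∷ l) with pt a | ∑-mono-unless Q pt l
  ... | inj₁ q  | _       = inj₁ (a , q)
  ... | inj₂ _  | inj₁ r  = inj₁ r
  ... | inj₂ ha | inj₂ hl = inj₂ (+-mono-≤ ha hl)

  ∑-strict-unless : ∀ {h k : A → ℕ} (Q : A → Set) → (∀ z → Q z ⊎ h z ≤ k z) →
                    ∀ {x l} → x ∈ l → h x < k x → ∃ Q ⊎ ∑ h l < ∑ k l
  ∑-strict-unless Q pt {l = a ∷ l} (here refl) hx with ∑-mono-unless Q pt l
  ... | inj₁ r  = inj₁ r
  ... | inj₂ hl = inj₂ (+-mono-<-≤ hx hl)
  ∑-strict-unless Q pt {l = a ∷ l} (there x∈) hx with pt a | ∑-strict-unless Q pt x∈ hx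
  ... | inj₁ q  | _       = inj₁ (a , q)
  ... | inj₂ _  | inj₁ r  = inj₁ r
  ... | inj₂ ha | inj₂ hl = inj₂ (+-mono-≤-< ha hl)

shift-step : ∀ fu gu ga S L fz → S < L + ga + fz → fu + ga ≤ 1 → fu + gu + S < suc L + gu + fz
shift-step fu gu ga S L fz S< fu+ga≤1 = begin
  suc (fu + gu + S)        ≡⟨ solve 4 (λ fu gu S one → one :+ (fu :+ gu :+ S) := fu :+ gu :+ (S :+ one))
                                      refl fu gu S 1 ⟩
  fu + gu + (S + 1)        ≤⟨ +-monoʳ-≤ (fu + gu) (≤-trans (≤-reflexive (+-comm S 1)) S<) ⟩
  fu + gu + (L + ga + fz)  ≡⟨ solve 5 (λ fu gu L ga fz → fu :+ gu :+ (L :+ ga :+ fz) := (fu :+ ga) :+ (L :+ gu :+ fz))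
                                      refl fu gu L ga fz ⟩
  fu + ga + (L + gu + fz)  ≤⟨ +-monoˡ-≤ (L + gu + fz) fu+ga≤1 ⟩
  suc L + gu + fz          ∎
  where
  open ≤-Reasoning
  open +-*-Solver using (solve; _:+_; _:=_)

m∸1≤n⇒2+n≰m : ∀ {m n} → m ∸ 1 ≤ n → ¬ 2 + n ≤ m
m∸1≤n⇒2+n≰m m∸1≤n (s≤s 1+n≤m∸1) = ≤⇒≯ m∸1≤n 1+n≤m∸1

-- Paths, and Ore-type counting in a graph

module _ {n : ℕ} (G : Graph n) where

  infix 4 _~_
  _~_ : Fin n → Fin n → Set
  _~_ = Adj G

  ~-sym : ∀ {u v} → u ~ v → v ~ u
  ~-sym {u} {v} = subst T (Graph.sym G u v)

  ~-irrefl : ∀ {v} → ¬ v ~ v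
  ~-irrefl {v} = subst T (irref G v)

  _~?_ : ∀ u v → Dec (u ~ v)
  u ~? v = T? (adj G u v)

  ≁⇒adj≡false : ∀ {u v} → ¬ u ~ v → adj G u v ≡ false
  ≁⇒adj≡false {u} {v} u≁v with adj G u v
  ... | true  = ⊥-elim (u≁v tt)
  ... | false = refl

  data Path : Fin n → List (Fin n) → Fin n → Set where
    [-] : ∀ {a} → Path a [ a ] a
    _◅_ : ∀ {u a vs z} → u ~ a → Path a vs z → Path u (u ∷ vs) z

  infixr 5 _◅_

  Path⇒IsPath : ∀ {a vs z} → Path a vs z → IsPath G vs
  Path⇒IsPath [-]             = one
  Path⇒IsPath (e ◅ [-])       = cons e one
  Path⇒IsPath (e ◅ e′ ◅ path) = cons e (Path⇒IsPath (e′ ◅ path))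

  _⟨_⟩_ : ∀ {a vs b c ws d} → Path a vs b → b ~ c → Path c ws d → Path a (vs ++ ws) d
  [-]        ⟨ e ⟩ q = e ◅ q
  (e′ ◅ p) ⟨ e ⟩ q = e′ ◅ (p ⟨ e ⟩ q)

  infixr 5 _⟨_⟩_

  Path-reverse : ∀ {a vs z} → Path a vs z → Path z (reverse vs) a
  Path-reverse [-] = [-]
  Path-reverse {a} (_◅_ {vs = vs} e p) =
    subst (λ ws → Path _ ws a) (sym (unfold-reverse a vs)) (Path-reverse p ⟨ ~-sym e ⟩ [-])

  Path-head : ∀ {a w vs z} → Path a (w ∷ vs) z → a ≡ w
  Path-head [-]     = refl
  Path-head (_ ◅ _) = refl

  Path-head∈ : ∀ {a vs z} → Path a vs z → a ∈ vs
  Path-head∈ [-]     = here refl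
  Path-head∈ (_ ◅ _) = here refl

  Path-last∈ : ∀ {a vs z} → Path a vs z → z ∈ vs
  Path-last∈ [-]      = here refl
  Path-last∈ (_ ◅ p) = there (Path-last∈ p)

  Path-split : ∀ us {u ws a z} → Path a (us ++ u ∷ ws) z → Path a (us ++ [ u ]) u × Path u (u ∷ ws) z
  Path-split []            p       with Path-head p
  ... | refl = [-] , p
  Path-split (_ ∷ [])      (e ◅ p) with Path-head p
  ... | refl = e ◅ [-] , p
  Path-split (_ ∷ u′ ∷ us) (e ◅ p) with Path-split (u′ ∷ us) p
  ... | p₁ , p₂ = e ◅ p₁ , p₂

  Path-unsnoc : ∀ us {v a b} → Path a (v ∷ us ++ [ b ]) b → ∃[ p ] Path a (v ∷ us) p × p ~ b
  Path-unsnoc []       (e ◅ p) with Path-head p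
  ... | refl = _ , [-] , e
  Path-unsnoc (u ∷ us) (e ◅ p) with Path-unsnoc us p
  ... | _ , p′ , e′ = _ , e ◅ p′ , e′

  Path-uncons : ∀ {u w vs z} → Path u (u ∷ w ∷ vs) z → u ~ w × Path w (w ∷ vs) z
  Path-uncons (e ◅ p) with Path-head p
  ... | refl = e , p

  Path-tail : ∀ {a vs z} → Path a vs z → ∃[ ws ] vs ≡ a ∷ ws
  Path-tail [-]     = [] , refl
  Path-tail (_ ◅ _) = _ , refl

  open Sums (_≟ᶠ_ {n})

  ∑-outside : List (Fin n) → (Fin n → ℕ) → ℕ
  ∑-outside P w = ∑ (outside P w) (allFin n)

  ∑-split-allFin : ∀ w {P} → Unique P → ∑ w (allFin n) ≡ ∑ w P + ∑-outside P w
  ∑-split-allFin = ∑-split (allFin⁺ n) ∈-allFin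

  order-split : ∀ {P} → Unique P → n ≡ length P + ∑-outside P (λ _ → 1)
  order-split {P} uP = begin
    n                                       ≡⟨ sym (length-tabulate {n = n} (λ z → z)) ⟩
    length (allFin n)                       ≡⟨ sym (∑-length (allFin n)) ⟩
    ∑ (λ _ → 1) (allFin n)                  ≡⟨ ∑-split-allFin (λ _ → 1) uP ⟩
    ∑ (λ _ → 1) P + ∑-outside P (λ _ → 1)   ≡⟨ cong (_+ ∑-outside P (λ _ → 1)) (∑-length P) ⟩
    length P + ∑-outside P (λ _ → 1)        ∎
    where open ≡-Reasoning

  length<order : ∀ {P x} → Unique P → x ∉ P → length P < n
  length<order {P} {x} uP x∉ = begin-strict
    length P                                  <⟨ m<m+n (length P) (s≤s z≤n) ⟩
    length P + 1                              ≡⟨ cong (length P +_) (sym (outside-∉ (λ _ → 1) x∉)) ⟩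
    length P + outside P (λ _ → 1) x          ≤⟨ +-monoʳ-≤ (length P) (∈⇒≤∑ (outside P (λ _ → 1)) (∈-allFin x)) ⟩
    length P + ∑-outside P (λ _ → 1)          ≡⟨ sym (order-split uP) ⟩
    n                                         ∎
    where open ≤-Reasoning

  hits : (Fin n → Bool) → (Fin n → Bool) → Fin n → ℕ
  hits f g z = 𝟙 (f z) + 𝟙 (g z)

  degree-sum-split : ∀ u w {P} → Unique P →
    degree G u + degree G w ≡ ∑ (hits (adj G u) (adj G w)) P + ∑-outside P (hits (adj G u) (adj G w))
  degree-sum-split u w {P} uP = begin
    degree G u + degree G w
      ≡⟨ cong₂ _+_ (∑-filter (adj G u) (allFin n)) (∑-filter (adj G w) (allFin n)) ⟩
    ∑ (𝟙 ∘ adj G u) (allFin n) + ∑ (𝟙 ∘ adj G w) (allFin n)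
      ≡⟨ sym (∑-+ (𝟙 ∘ adj G u) (𝟙 ∘ adj G w) (allFin n)) ⟩
    ∑ (hits (adj G u) (adj G w)) (allFin n)
      ≡⟨ ∑-split-allFin (hits (adj G u) (adj G w)) uP ⟩
    ∑ (hits (adj G u) (adj G w)) P + ∑-outside P (hits (adj G u) (adj G w))
      ∎
    where open ≡-Reasoning

  record Crossing (f g : Fin n → Bool) (a : Fin n) (vs : List (Fin n)) (z : Fin n) : Set where
    constructor crossing
    field
      {before after} : List (Fin n)
      {u u′}         : Fin n
      vs≡            : vs ≡ before ++ u ∷ u′ ∷ after
      to-u           : Path a (before ++ [ u ]) u
      from-u′        : Path u′ (u′ ∷ after) z
      f-u            : T (f u)
      g-u′           : T (g u′)

  -- Without a crossing, the successor of every f-vertex is not a g-vertex: shifting the f-vertices one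
  -- step along the path makes them disjoint from the g-vertices, up to the two ends.
  crossing-or-bound : ∀ f g {a vs z} → Path a vs z →
    Crossing f g a vs z ⊎ ∑ (hits f g) vs < length vs + 𝟙 (g a) + 𝟙 (f z)
  crossing-or-bound f g {a} [-] =
    inj₂ (s≤s (≤-reflexive (trans (+-identityʳ _) (+-comm (𝟙 (f a)) (𝟙 (g a))))))
  crossing-or-bound f g (_◅_ {u} {a′} {vs} {z} e p) with crossing-or-bound f g p
  ... | inj₁ (crossing {before} eq p₁ p₂ fu gu′) =
    inj₁ (crossing {before = u ∷ before} (cong (u ∷_) eq) (e ◅ p₁) p₂ fu gu′)
  ... | inj₂ bound with Path-tail p | f u in fu | g a′ in ga′
  ... | ws , refl | true | true =
    inj₁ (crossing {before = []} {ws} {u} {a′} refl [-] p (subst T (sym fu) tt) (subst T (sym ga′) tt))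
  ... | _ | true  | false =
    inj₂ (shift-step 1 (𝟙 (g u)) 0 (∑ (hits f g) vs) (length vs) (𝟙 (f z)) bound (s≤s z≤n))
  ... | _ | false | b     =
    inj₂ (shift-step 0 (𝟙 (g u)) (𝟙 b) (∑ (hits f g) vs) (length vs) (𝟙 (f z)) bound (𝟙≤1 b))

  crossing-or-count : ∀ f g {a vs z} → Path a vs z → g a ≡ false → f z ≡ false →
    Crossing f g a vs z ⊎ ∑ (hits f g) vs < length vs
  crossing-or-count f g {a} {vs} {z} path ga fz with crossing-or-bound f g path
  ... | inj₁ c     = inj₁ c
  ... | inj₂ bound rewrite ga | fz | +-identityʳ (length vs) | +-identityʳ (length vs) = inj₂ bound

  open DecMembership (_≟ᶠ_ {n}) using (_∈?_)

  outside-count : ∀ f g {P x} → x ∉ P → f x ≡ false → g x ≡ false →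
    (∃[ y ] y ∉ P × T (f y) × T (g y)) ⊎ ∑-outside P (hits f g) < ∑-outside P (λ _ → 1)
  outside-count f g {P} {x} x∉ fx gx =
    ∑-strict-unless (λ y → y ∉ P × T (f y) × T (g y)) pointwise (∈-allFin x) at-x
    where
    hits≤1 : ∀ z → T (f z) × T (g z) ⊎ hits f g z ≤ 1
    hits≤1 z with f z | g z
    ... | true  | true  = inj₁ (tt , tt)
    ... | true  | false = inj₂ ≤-refl
    ... | false | b     = inj₂ (𝟙≤1 b)
    pointwise : ∀ z → (z ∉ P × T (f z) × T (g z)) ⊎ outside P (hits f g) z ≤ outside P (λ _ → 1) z
    pointwise z = by-membership (z ∈? P)
      where
      by-membership : Dec (z ∈ P) → (z ∉ P × T (f z) × T (g z)) ⊎ outside P (hits f g) z ≤ outside P (λ _ → 1) z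
      by-membership (yes z∈) = inj₂ (≤-reflexive (trans (outside-∈ (hits f g) z∈) (sym (outside-∈ (λ _ → 1) z∈))))
      by-membership (no z∉) with hits≤1 z
      ... | inj₁ (fz , gz) = inj₁ (z∉ , fz , gz)
      ... | inj₂ ≤1 = inj₂ (subst₂ _≤_ (sym (outside-∉ (hits f g) z∉)) (sym (outside-∉ (λ _ → 1) z∉)) ≤1)
    at-x : outside P (hits f g) x < outside P (λ _ → 1) x
    at-x rewrite outside-∉ (hits f g) x∉ | outside-∉ {P} (λ _ → 1) x∉ | fx | gx = s≤s z≤n

  degree-sum-bound : ∀ u w {P} → Unique P →
    ∑ (hits (adj G u) (adj G w)) P < length P →
    ∑-outside P (hits (adj G u) (adj G w)) < ∑-outside P (λ _ → 1) →
    2 + (degree G u + degree G w) ≤ n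
  degree-sum-bound u w {P} uP on-P off-P = begin
    2 + (degree G u + degree G w)  ≡⟨ cong (2 +_) (degree-sum-split u w uP) ⟩
    2 + (A + B)                    ≡⟨ cong suc (sym (+-suc A B)) ⟩
    suc A + suc B                  ≤⟨ +-mono-≤ on-P off-P ⟩
    length P + ∑-outside P (λ _ → 1) ≡⟨ sym (order-split uP) ⟩
    n                              ∎
    where
    open ≤-Reasoning
    A = ∑ (hits (adj G u) (adj G w)) P
    B = ∑-outside P (hits (adj G u) (adj G w))

  -- Rerouting a path to absorb an outside vertex

  record LongerPath (k : ℕ) : Set where
    constructor longer
    field
      {start end} : Fin n
      {vertices}  : List (Fin n)
      path        : Path start vertices end
      unique      : Unique vertices
      longer-than : k < length vertices

  insert-into : ∀ {a vs z P} y → Path a vs z → vs ↭ y ∷ P → y ∉ P → Unique P → LongerPath (length P)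
  insert-into y path vs↭ y∉ uP =
    longer path (Unique-resp-↭ (↭-sym vs↭) (Unique-∷ y∉ uP)) (≤-reflexive (sym (↭-length vs↭)))

  open CommutativeMonoidSolver (++-commutativeMonoid {A = Fin n}) using (solve; _⊕_; _⊜_)

  record Hub (x : Fin n) (L : List (Fin n)) (b : Fin n) (M : List (Fin n)) : Set where
    field
      {v₁ p q vₖ} : Fin n
      left   : Path v₁ L p
      right  : Path q M vₖ
      p~b    : p ~ b
      b~q    : b ~ q
      b~v₁   : b ~ v₁
      b~vₖ   : b ~ vₖ
      x~b    : x ~ b
      x≁v₁   : ¬ x ~ v₁
      x≁vₖ   : ¬ x ~ vₖ
      unique : Unique (L ++ b ∷ M)
      x∉     : x ∉ L ++ b ∷ M

  Hub-reverse : ∀ {x L b M} → Hub x L b M → Hub x (reverse M) b (reverse L)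
  Hub-reverse {L = L} {b} {M} h = record
    { left = Path-reverse right ; right = Path-reverse left
    ; p~b = ~-sym b~q ; b~q = ~-sym p~b ; b~v₁ = b~vₖ ; b~vₖ = b~v₁ ; x~b = x~b
    ; x≁v₁ = x≁vₖ ; x≁vₖ = x≁v₁
    ; unique = Unique-resp-↭ (↭-sym (reverse-around L b M)) unique
    ; x∉ = x∉ ∘ ∈-resp-↭ (reverse-around L b M)
    }
    where open Hub h

  module _ {x L b M} (h : Hub x L b M) where
    open Hub h

    private
      extend-by-x : ∀ {a vs z} → Path a vs z → vs ↭ x ∷ L ++ b ∷ M → LongerPath (length (L ++ b ∷ M))
      extend-by-x path vs↭ = insert-into x path vs↭ x∉ unique

      crossing-left-↭ : ∀ l₁ u R → R ++ ([ x ] ++ [ b ] ++ l₁ ++ [ u ] ++ M) ↭ x ∷ (l₁ ++ u ∷ R) ++ b ∷ M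
      crossing-left-↭ l₁ u R = solve 6 (λ l₁ u x b R M → R ⊕ x ⊕ b ⊕ l₁ ⊕ u ⊕ M ⊜ x ⊕ (l₁ ⊕ u ⊕ R) ⊕ b ⊕ M)
        ↭-refl l₁ [ u ] [ x ] [ b ] R M

      crossing-right-↭ : ∀ m₁ u u′ m₂ →
        (m₁ ++ [ u ]) ++ (L ++ [ b ] ++ [ x ] ++ [ u′ ] ++ m₂) ↭ x ∷ L ++ b ∷ (m₁ ++ u ∷ u′ ∷ m₂)
      crossing-right-↭ m₁ u u′ m₂ =
        solve 7 (λ m₁ u u′ m₂ L b x → (m₁ ⊕ u) ⊕ L ⊕ b ⊕ x ⊕ u′ ⊕ m₂ ⊜ x ⊕ L ⊕ b ⊕ m₁ ⊕ u ⊕ u′ ⊕ m₂)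
          ↭-refl m₁ [ u ] [ u′ ] m₂ L [ b ] [ x ]

    x~q-route : x ~ q → LongerPath (length (L ++ b ∷ M))
    x~q-route x~q = extend-by-x (left ⟨ p~b ⟩ ~-sym x~b ◅ x~q ◅ right)
      (solve 4 (λ L b x M → L ⊕ b ⊕ x ⊕ M ⊜ x ⊕ L ⊕ b ⊕ M) ↭-refl L [ b ] [ x ] M)

    x~p-route : x ~ p → LongerPath (length (L ++ b ∷ M))
    x~p-route x~p = extend-by-x (left ⟨ ~-sym x~p ⟩ x~b ◅ b~q ◅ right)
      (solve 4 (λ L b x M → L ⊕ x ⊕ b ⊕ M ⊜ x ⊕ L ⊕ b ⊕ M) ↭-refl L [ b ] [ x ] M)

    -- v₁ … p q … vₖ b x
    p~q-route : p ~ q → LongerPath (length (L ++ b ∷ M))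
    p~q-route p~q = extend-by-x (left ⟨ p~q ⟩ right ⟨ ~-sym b~vₖ ⟩ ~-sym x~b ◅ [-])
      (solve 4 (λ L b x M → L ⊕ M ⊕ b ⊕ x ⊜ x ⊕ L ⊕ b ⊕ M) ↭-refl L [ b ] [ x ] M)

    -- x b p … v₁ q … vₖ
    q~v₁-route : q ~ v₁ → LongerPath (length (L ++ b ∷ M))
    q~v₁-route q~v₁ = extend-by-x (x~b ◅ ~-sym p~b ◅ Path-reverse left ⟨ ~-sym q~v₁ ⟩ right) perm
      where
      perm : x ∷ b ∷ reverse L ++ M ↭ x ∷ L ++ b ∷ M
      perm = via-reverse L ([ x ] ++ [ b ] ++ M)
        (solve 4 (λ x b RL M → x ⊕ b ⊕ RL ⊕ M ⊜ RL ⊕ x ⊕ b ⊕ M) ↭-refl [ x ] [ b ] (reverse L) M)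
        (solve 4 (λ x b L M → L ⊕ x ⊕ b ⊕ M ⊜ x ⊕ L ⊕ b ⊕ M) ↭-refl [ x ] [ b ] L M)

    -- v₁ … p b x y q … vₖ
    x-q-common-outside : ∀ {y} → y ∉ L ++ b ∷ M → x ~ y → q ~ y → LongerPath (length (L ++ b ∷ M))
    x-q-common-outside {y} y∉ x~y q~y = longer-by-two (insert-into x path perm x∉′ (Unique-∷ y∉ unique))
      where
      path = left ⟨ p~b ⟩ ~-sym x~b ◅ x~y ◅ ~-sym q~y ◅ right
      perm : L ++ b ∷ x ∷ y ∷ M ↭ x ∷ y ∷ L ++ b ∷ M
      perm = solve 5 (λ L b x y M → L ⊕ b ⊕ x ⊕ y ⊕ M ⊜ x ⊕ y ⊕ L ⊕ b ⊕ M) ↭-refl L [ b ] [ x ] [ y ] M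
      x∉′ : x ∉ y ∷ L ++ b ∷ M
      x∉′ (here refl) = ~-irrefl x~y
      x∉′ (there x∈)  = x∉ x∈
      longer-by-two : LongerPath (suc (length (L ++ b ∷ M))) → LongerPath (length (L ++ b ∷ M))
      longer-by-two (longer path′ u′ >) = longer path′ u′ (<-trans (n<1+n _) >)

    -- v₁ … u x b p … u′ q … vₖ
    x-q-crossing-left : Crossing (adj G x) (adj G q) v₁ L p → LongerPath (length (L ++ b ∷ M))
    x-q-crossing-left (crossing {l₁} {l₂} {u} {u′} L≡ to-u from-u′ x~u q~u′) =
      extend-by-x (to-u ⟨ ~-sym x~u ⟩ x~b ◅ ~-sym p~b ◅ Path-reverse from-u′ ⟨ ~-sym q~u′ ⟩ right)
        (subst (λ L′ → _ ↭ x ∷ L′ ++ b ∷ M) (sym L≡) perm)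
      where
      R = u′ ∷ l₂
      perm : (l₁ ++ [ u ]) ++ x ∷ b ∷ reverse R ++ M ↭ x ∷ (l₁ ++ u ∷ R) ++ b ∷ M
      perm = via-reverse R ([ x ] ++ [ b ] ++ l₁ ++ [ u ] ++ M)
        (solve 6 (λ l₁ u x b RR M → (l₁ ⊕ u) ⊕ x ⊕ b ⊕ RR ⊕ M ⊜ RR ⊕ x ⊕ b ⊕ l₁ ⊕ u ⊕ M)
          ↭-refl l₁ [ u ] [ x ] [ b ] (reverse R) M)
        (crossing-left-↭ l₁ u R)

    -- v₁ … p b x u … q u′ … vₖ
    x-q-crossing-right : Crossing (adj G x) (adj G q) q M vₖ → LongerPath (length (L ++ b ∷ M))
    x-q-crossing-right (crossing {m₁} {m₂} {u} {u′} M≡ to-u from-u′ x~u q~u′) =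
      extend-by-x (left ⟨ p~b ⟩ ~-sym x~b ◅ x~u ◅ Path-reverse to-u ⟨ q~u′ ⟩ from-u′)
        (subst (λ M′ → _ ↭ x ∷ L ++ b ∷ M′) (sym M≡) perm)
      where
      R = m₁ ++ [ u ]
      perm : L ++ b ∷ x ∷ reverse R ++ u′ ∷ m₂ ↭ x ∷ L ++ b ∷ m₁ ++ u ∷ u′ ∷ m₂
      perm = via-reverse R (L ++ [ b ] ++ [ x ] ++ [ u′ ] ++ m₂)
        (solve 6 (λ L b x RR u′ m₂ → L ⊕ b ⊕ x ⊕ RR ⊕ u′ ⊕ m₂ ⊜ RR ⊕ L ⊕ b ⊕ x ⊕ u′ ⊕ m₂)
          ↭-refl L [ b ] [ x ] (reverse R) [ u′ ] m₂)
        (crossing-right-↭ m₁ u u′ m₂)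

    -- v₁ … p vₖ … q b x
    p~vₖ-route : p ~ vₖ → LongerPath (length (L ++ b ∷ M))
    p~vₖ-route p~vₖ = extend-by-x (left ⟨ p~vₖ ⟩ Path-reverse right ⟨ ~-sym b~q ⟩ ~-sym x~b ◅ [-]) perm
      where
      perm : L ++ reverse M ++ b ∷ x ∷ [] ↭ x ∷ L ++ b ∷ M
      perm = via-reverse M (L ++ [ b ] ++ [ x ])
        (solve 4 (λ L RM b x → L ⊕ RM ⊕ b ⊕ x ⊜ RM ⊕ L ⊕ b ⊕ x) ↭-refl L (reverse M) [ b ] [ x ])
        (solve 4 (λ L M b x → M ⊕ L ⊕ b ⊕ x ⊜ x ⊕ L ⊕ b ⊕ M) ↭-refl L M [ b ] [ x ])

    -- vₖ … q b v₁ … p y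
    p-outside-neighbour : ∀ {y} → y ∉ L ++ b ∷ M → p ~ y → LongerPath (length (L ++ b ∷ M))
    p-outside-neighbour {y} y∉ p~y =
      insert-into y (Path-reverse right ⟨ ~-sym b~q ⟩ b~v₁ ◅ left ⟨ p~y ⟩ [-]) perm y∉ unique
      where
      perm : reverse M ++ b ∷ L ++ y ∷ [] ↭ y ∷ L ++ b ∷ M
      perm = via-reverse M ([ b ] ++ L ++ [ y ]) ↭-refl
        (solve 4 (λ L M b y → M ⊕ b ⊕ L ⊕ y ⊜ y ⊕ L ⊕ b ⊕ M) ↭-refl L M [ b ] [ y ])

    -- x b v₁ … u p … u′ q … vₖ
    p-q-crossing-left : Crossing (adj G p) (adj G q) v₁ L p → LongerPath (length (L ++ b ∷ M))
    p-q-crossing-left (crossing {l₁} {l₂} {u} {u′} L≡ to-u from-u′ p~u q~u′) =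
      extend-by-x (x~b ◅ b~v₁ ◅ to-u ⟨ ~-sym p~u ⟩ Path-reverse from-u′ ⟨ ~-sym q~u′ ⟩ right)
        (subst (λ L′ → _ ↭ x ∷ L′ ++ b ∷ M) (sym L≡) perm)
      where
      R = u′ ∷ l₂
      perm : x ∷ b ∷ (l₁ ++ [ u ]) ++ reverse R ++ M ↭ x ∷ (l₁ ++ u ∷ R) ++ b ∷ M
      perm = via-reverse R ([ x ] ++ [ b ] ++ l₁ ++ [ u ] ++ M)
        (solve 6 (λ l₁ u x b RR M → x ⊕ b ⊕ (l₁ ⊕ u) ⊕ RR ⊕ M ⊜ RR ⊕ x ⊕ b ⊕ l₁ ⊕ u ⊕ M)
          ↭-refl l₁ [ u ] [ x ] [ b ] (reverse R) M)
        (crossing-left-↭ l₁ u R)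

    -- v₁ … p u … q u′ … vₖ b x
    p-q-crossing-right : Crossing (adj G p) (adj G q) q M vₖ → LongerPath (length (L ++ b ∷ M))
    p-q-crossing-right (crossing {m₁} {m₂} {u} {u′} M≡ to-u from-u′ p~u q~u′) =
      extend-by-x (left ⟨ p~u ⟩ Path-reverse to-u ⟨ q~u′ ⟩ from-u′ ⟨ ~-sym b~vₖ ⟩ ~-sym x~b ◅ [-])
        (subst (λ M′ → _ ↭ x ∷ L ++ b ∷ M′) (sym M≡) perm)
      where
      R = m₁ ++ [ u ]
      perm : L ++ reverse R ++ (u′ ∷ m₂) ++ b ∷ x ∷ [] ↭ x ∷ L ++ b ∷ m₁ ++ u ∷ u′ ∷ m₂
      perm = via-reverse R (L ++ [ b ] ++ [ x ] ++ [ u′ ] ++ m₂)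
        (solve 6 (λ L b x RR u′ m₂ → L ⊕ RR ⊕ (u′ ⊕ m₂) ⊕ b ⊕ x ⊜ RR ⊕ L ⊕ b ⊕ x ⊕ u′ ⊕ m₂)
          ↭-refl L [ b ] [ x ] (reverse R) [ u′ ] m₂)
        (crossing-right-↭ m₁ u u′ m₂)

    not-heavy : ∀ u w → ∑ (hits (adj G u) (adj G w)) L < length L → ∑ (hits (adj G u) (adj G w)) M < length M →
      ∑-outside (L ++ b ∷ M) (hits (adj G u) (adj G w)) < ∑-outside (L ++ b ∷ M) (λ _ → 1) →
      ¬ n ∸ 1 ≤ degree G u + degree G w
    not-heavy u w on-L on-M off-P heavy = m∸1≤n⇒2+n≰m heavy
      (degree-sum-bound u w unique (∑-around-< (hits (adj G u) (adj G w)) L b M on-L hits≤2 on-M) off-P)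
      where
      hits≤2 : hits (adj G u) (adj G w) b ≤ 2
      hits≤2 = +-mono-≤ (𝟙≤1 (adj G u b)) (𝟙≤1 (adj G w b))

    x-q-heavy : ¬ x ~ p → ¬ x ~ q → n ∸ 1 ≤ degree G x + degree G q → LongerPath (length (L ++ b ∷ M))
    x-q-heavy x≁p x≁q heavy with q ~? v₁
    ... | yes q~v₁ = q~v₁-route q~v₁
    ... | no q≁v₁ with crossing-or-count (adj G x) (adj G q) left (≁⇒adj≡false q≁v₁) (≁⇒adj≡false x≁p)
    ... | inj₁ c = x-q-crossing-left c
    ... | inj₂ on-L with crossing-or-count (adj G x) (adj G q) right (irref G q) (≁⇒adj≡false x≁vₖ)
    ... | inj₁ c = x-q-crossing-right c
    ... | inj₂ on-M with outside-count (adj G x) (adj G q) x∉ (irref G x) (≁⇒adj≡false (x≁q ∘ ~-sym))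
    ... | inj₁ (y , y∉ , x~y , q~y) = x-q-common-outside y∉ x~y q~y
    ... | inj₂ off-P = ⊥-elim (not-heavy x q on-L on-M off-P heavy)

    p-q-heavy : ¬ x ~ p → ¬ x ~ q → n ∸ 1 ≤ degree G p + degree G q → LongerPath (length (L ++ b ∷ M))
    p-q-heavy x≁p x≁q heavy with q ~? v₁ | p ~? vₖ
    ... | yes q~v₁ | _        = q~v₁-route q~v₁
    ... | no _     | yes p~vₖ = p~vₖ-route p~vₖ
    ... | no q≁v₁  | no p≁vₖ with crossing-or-count (adj G p) (adj G q) left (≁⇒adj≡false q≁v₁) (irref G p)
    ... | inj₁ c = p-q-crossing-left c
    ... | inj₂ on-L with crossing-or-count (adj G p) (adj G q) right (irref G q) (≁⇒adj≡false p≁vₖ)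
    ... | inj₁ c = p-q-crossing-right c
    ... | inj₂ on-M
      with outside-count (adj G p) (adj G q) x∉ (≁⇒adj≡false (x≁p ∘ ~-sym)) (≁⇒adj≡false (x≁q ∘ ~-sym))
    ... | inj₁ (y , y∉ , p~y , _) = p-outside-neighbour y∉ p~y
    ... | inj₂ off-P = ⊥-elim (not-heavy p q on-L on-M off-P heavy)

  prepend : ∀ {y a P z} → y ~ a → Path a P z → y ∉ P → Unique P → LongerPath (length P)
  prepend y~a path = insert-into _ (y~a ◅ path) ↭-refl

  append : ∀ {a P z y} → Path a P z → z ~ y → y ∉ P → Unique P → LongerPath (length P)
  append {P = P} {y = y} path z~y = insert-into y (path ⟨ z~y ⟩ [-]) (++-comm P [ y ])

  -- m … z a … c x, where c m is an edge of the path
  via-cycle : ∀ {a P z x c} → Path a P z → Unique P → x ∉ P → ¬ x ~ z → a ~ z → x ~ c → c ∈ P →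
              LongerPath (length P)
  via-cycle {x = x} {c} path uP x∉ x≁z a~z x~c c∈ with ∈-∃++ c∈
  ... | L , [] , refl with Path-split L path
  ...   | _ , [-] = ⊥-elim (x≁z x~c)
  via-cycle {x = x} {c} path uP x∉ x≁z a~z x~c c∈ | L , m ∷ M′ , refl with Path-split L path
  ...   | to-c , from-c with Path-uncons from-c
  ...     | _ , from-m = insert-into x (from-m ⟨ ~-sym a~z ⟩ to-c ⟨ ~-sym x~c ⟩ [-])
            (solve 4 (λ M L c x → M ⊕ (L ⊕ c) ⊕ x ⊜ x ⊕ L ⊕ c ⊕ M) ↭-refl (m ∷ M′) L [ c ] [ x ]) x∉ uP

  module _ (heavy : ClawO₋₁Heavy G) {x L b M} (h : Hub x L b M) where
    open Hub h

    Hub-longer : LongerPath (length (L ++ b ∷ M))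
    Hub-longer with x ~? q | x ~? p | p ~? q
    ... | yes x~q | _       | _      = x~q-route h x~q
    ... | no _    | yes x~p | _      = x~p-route h x~p
    ... | no _    | no _    | yes p~q = p~q-route h p~q
    ... | no x≁q  | no x≁p  | no p≁q with heavy b x p q claw
      where
      p∈L : p ∈ L
      p∈L = Path-last∈ left
      q∈M : q ∈ M
      q∈M = Path-head∈ right
      claw : InducedClaw G b x p q
      claw = record
        { cx = ~-sym x~b ; cy = ~-sym p~b ; cz = b~q
        ; x≢y = λ { refl → x∉ (∈-++⁺ˡ p∈L) }
        ; x≢z = λ { refl → x∉ (∈-++⁺ʳ L (there q∈M)) }
        ; y≢z = Unique-++⇒disjoint L unique p∈L (there q∈M)
        ; ¬xy = x≁p ; ¬xz = x≁q ; ¬yz = p≁q }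
    -- The pair (x, p) is the pair (x, q) of the reversed hub.
    ... | inj₁ heavy-xp =
      subst LongerPath (↭-length (reverse-around L b M)) (x-q-heavy (Hub-reverse h) x≁q x≁p heavy-xp)
    ... | inj₂ (inj₁ heavy-xq) = x-q-heavy h x≁p x≁q heavy-xq
    ... | inj₂ (inj₂ heavy-pq) = p-q-heavy h x≁p x≁q heavy-pq

  -- P₄-free graphs and the extension step

  module _ (p4-free : P4Free G) where

    walk-reaches-within-2 : ∀ {a w} → Walk G a w → ∀ {u} → u ~ a → u ~ w ⊎ ∃[ c ] u ~ c × c ~ w
    walk-reaches-within-2 here u~a = inj₁ u~a
    walk-reaches-within-2 {a} {w} (step a~a′ walk) {u} u~a with walk-reaches-within-2 walk a~a′
    ... | inj₁ a~w = inj₂ (a , u~a , a~w)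
    ... | inj₂ (c , a~c , c~w) with u ~? w | u ~? c | a ~? w
    ... | yes u~w | _       | _       = inj₁ u~w
    ... | no _    | yes u~c | _       = inj₂ (c , u~c , c~w)
    ... | no _    | no _    | yes a~w = inj₂ (a , u~a , a~w)
    ... | no u≁w  | no u≁c  | no a≁w  = ⊥-elim (p4-free u a c w record
          { ab = u~a ; bc = a~c ; cd = c~w ; ¬ac = u≁c ; ¬bd = a≁w ; ¬ad = u≁w })

    common-neighbour : Connected G → ∀ {x a} → x ≢ a → ¬ x ~ a → ∃[ c ] x ~ c × c ~ a
    common-neighbour connected {x} {a} x≢a x≁a with connected x a
    ... | here = ⊥-elim (x≢a refl)
    ... | step x~x′ walk with walk-reaches-within-2 walk x~x′
    ...   | inj₁ x~a = ⊥-elim (x≁a x~a)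
    ...   | inj₂ c   = c

    chord : ∀ {a c x d z} → ¬ a ~ z → ¬ x ~ a → a ~ c → c ~ x → x ~ d → d ~ z → c ~ z ⊎ d ~ a
    chord {a} {c} {x} {d} {z} a≁z x≁a a~c c~x x~d d~z with c ~? z | d ~? a | c ~? d
    ... | yes c~z | _       | _       = inj₁ c~z
    ... | no _    | yes d~a | _       = inj₂ d~a
    ... | no _    | no d≁a  | no c≁d  = ⊥-elim (p4-free a c x d record
          { ab = a~c ; bc = c~x ; cd = x~d ; ¬ac = x≁a ∘ ~-sym ; ¬bd = c≁d ; ¬ad = d≁a ∘ ~-sym })
    ... | no c≁z  | no d≁a  | yes c~d = ⊥-elim (p4-free a c d z record
          { ab = a~c ; bc = c~d ; cd = d~z ; ¬ac = d≁a ∘ ~-sym ; ¬bd = c≁z ; ¬ad = a≁z })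

  via-hub : ClawO₋₁Heavy G → ∀ {a P z x b} → Path a P z → Unique P → x ∉ P → ¬ x ~ a → ¬ x ~ z →
            x ~ b → b ~ a → b ~ z → b ∈ P → LongerPath (length P)
  via-hub heavy {b = b} path uP x∉ x≁a x≁z x~b b~a b~z b∈ with ∈-∃++ b∈
  ... | [] , _ , refl = ⊥-elim (~-irrefl (subst (b ~_) (Path-head path) b~a))
  via-hub heavy {b = b} path uP x∉ x≁a x≁z x~b b~a b~z b∈ | L , [] , refl with Path-split L path
  ...   | _ , [-] = ⊥-elim (~-irrefl b~z)
  via-hub heavy {b = b} path uP x∉ x≁a x≁z x~b b~a b~z b∈ | v ∷ l , q ∷ M , refl
    with Path-split (v ∷ l) path
  ... | to-b , from-b with Path-unsnoc l to-b | Path-uncons from-b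
  ...   | _ , left , p~b | b~q , right = Hub-longer heavy (record
          { left = left ; right = right ; p~b = p~b ; b~q = b~q ; b~v₁ = b~a ; b~vₖ = b~z ; x~b = x~b
          ; x≁v₁ = x≁a ; x≁vₖ = x≁z ; unique = uP ; x∉ = x∉ })

  module _ (connected : Connected G) (heavy : ClawO₋₁Heavy G) (p4-free : P4Free G) where

    extend : ∀ {a P z x} → Path a P z → Unique P → x ∉ P → LongerPath (length P)
    extend {a} {P} {z} {x} path uP x∉ with x ~? a | x ~? z
    ... | yes x~a | _       = prepend x~a path x∉ uP
    ... | no _    | yes x~z = append path (~-sym x~z) x∉ uP
    ... | no x≁a  | no x≁z
      with common-neighbour p4-free connected (λ { refl → x∉ (Path-head∈ path) }) x≁a
         | common-neighbour p4-free connected (λ { refl → x∉ (Path-last∈ path) }) x≁z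
    ... | c , x~c , c~a | d , x~d , d~z with c ∈? P | d ∈? P
    ... | no c∉  | _      = prepend c~a path c∉ uP
    ... | yes _  | no d∉  = append path (~-sym d~z) d∉ uP
    ... | yes c∈ | yes d∈ with a ~? z
    ... | yes a~z = via-cycle path uP x∉ x≁z a~z x~c c∈
    ... | no a≁z with chord p4-free a≁z x≁a (~-sym c~a) (~-sym x~c) x~d d~z
    ... | inj₁ c~z = via-hub heavy path uP x∉ x≁a x≁z x~c c~a c~z c∈
    ... | inj₂ d~a = via-hub heavy path uP x∉ x≁a x≁z x~d d~a d~z d∈

    grow : ∀ fuel {a P z} → Path a P z → Unique P → n ≤ fuel + length P → Traceable G
    grow fuel {P = P} path uP n≤ with all? (_∈? P)
    ... | yes all∈ = P , Path⇒IsPath path , uP , all∈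
    ... | no ¬all∈ with ¬∀⟶∃¬ n (_∈ P) (_∈? P) ¬all∈ | fuel
    ...   | x , x∉ | zero   = ⊥-elim (<⇒≱ (length<order uP x∉) n≤)
    ...   | x , x∉ | suc fuel′ with extend path uP x∉
    ...     | longer {vertices = P′} path′ uP′ P<P′ = grow fuel′ path′ uP′ (begin
      n                      ≤⟨ n≤ ⟩
      suc fuel′ + length P   ≡⟨ sym (+-suc fuel′ (length P)) ⟩
      fuel′ + suc (length P) ≤⟨ +-monoʳ-≤ fuel′ P<P′ ⟩
      fuel′ + length P′      ∎)
      where open ≤-Reasoning

    traceable : Fin n → Traceable G
    traceable v = grow n ([-] {v}) (Unique-∷ (λ ()) []) (m≤m+n n 1)

theorem8 : ∀ {n : ℕ} (G : Graph n) → Connected G → ClawO₋₁Heavy G → P4Free G → Traceable G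
theorem8 {zero}  G _         _     _       = [] , nil , [] , λ ()
theorem8 {suc n} G connected heavy p4-free = traceable G connected heavy p4-free Fin.zero
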